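{- Let $G=(V,E)$ be a regular graph, let $n=|V|$, and suppose the optimal value of Minimum Sum Vertex Cover, measured as the average cover time of an edge, equals $\left(\frac14+\delta\right)n$ for a real number $\delta\ge 0$, i.e. $\mathrm{MSVC}(G)/|E|=\left(\frac14+\delta\right)n$. Then an optimal ordering covers at least a $(1-\sqrt\delta)$ fraction of the edges of $E$ within its first $n/2$ steps (i.e. at least $(1-\sqrt\delta)|E|$ edges have at least one endpoint among the first $n/2$ vertices of the ordering).
   Context: Minimum Sum Vertex Cover: for a graph $G=(V,E)$ with $n=|V|$, an ordering is a bijection $\sigma\colon\{1,\dots,n\}\to V$; for an edge $e=(u,v)$ its cover time is $c_{\sigma,e}=\min(\sigma^{ -1}(u),\sigma^{ -1}(v))$; $\mathrm{SVC}_G(\sigma)=\sum_{e\in E}c_{\sigma,e}$, and $\mathrm{MSVC}(G)=\min_\sigma\mathrm{SVC}_G(\sigma)$. An optimal ordering is one attaining this minimum. A graph is regular if all vertices have the same degree. -}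

module Defs where

open import Data.Nat using (ℕ; suc; _+_; _*_; _∸_; _≤_; _<_; _⊔_; _⊓_; _≤?_; _≟_)
open import Data.Fin using (Fin; toℕ)
open import Data.Fin.Permutation using (Permutation′; _⟨$⟩ˡ_)
open import Data.Product using (_×_; _,_; ∃)
open import Data.List using (List; length; filter; map)
open import Data.Nat.ListAction using (sum)
open import Data.List.Relation.Unary.Unique.Propositional using (Unique)
open import Data.List.Relation.Unary.All using (All)
open import Data.Sum using (_⊎_)
open import Relation.Binary.PropositionalEquality using (_≡_)
open import Relation.Nullary using (Dec)
import Relation.Nullary.Decidable as Dec

-- Each edge {u,v} is stored once as the pair (u , v) with toℕ u < toℕ v
-- (so no loops), and the edge list has no repetitions (no multi-edges).
record Graph (n : ℕ) : Set where
  field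
    edges   : List (Fin n × Fin n)
    ordered : All (λ e → toℕ (Data.Product.proj₁ e) < toℕ (Data.Product.proj₂ e)) edges
    unique  : Unique edges
open Graph public

numEdges : ∀ {n} → Graph n → ℕ
numEdges G = length (edges G)

Incident : ∀ {n} → Fin n → Fin n × Fin n → Set
Incident v (a , b) = (a ≡ v) ⊎ (b ≡ v)

incident? : ∀ {n} (v : Fin n) (e : Fin n × Fin n) → Dec (Incident v e)
incident? v (a , b) = Data.Fin._≟_ a v Dec.⊎-dec Data.Fin._≟_ b v

degree : ∀ {n} → Graph n → Fin n → ℕ
degree G v = length (filter (incident? v) (edges G))

Regular : ∀ {n} → Graph n → Set
Regular G = ∃ λ d → ∀ v → degree G v ≡ d

-- An ordering σ : {1..n} → V is a permutation of Fin n; σ ⟨$⟩ʳ i is the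
-- vertex at (0-based) position i.  The 1-based position σ⁻¹(v):
position : ∀ {n} → Permutation′ n → Fin n → ℕ
position σ v = suc (toℕ (σ ⟨$⟩ˡ v))

coverTime : ∀ {n} → Permutation′ n → Fin n × Fin n → ℕ
coverTime σ (u , v) = position σ u ⊓ position σ v

SVC : ∀ {n} → Graph n → Permutation′ n → ℕ
SVC G σ = sum (map (coverTime σ) (edges G))

Optimal : ∀ {n} → Graph n → Permutation′ n → Set
Optimal G σ = ∀ (τ : Permutation′ _) → SVC G σ ≤ SVC G τ

coveredInHalf : ∀ {n} → Graph n → Permutation′ n → ℕ
coveredInHalf {n} G σ = length (filter (λ e → 2 * coverTime σ e ≤? n) (edges G))

-- For an ordering σ let p(i) be the number of edges first covered at the 0-based
-- step i.  Each of them meets the i-th vertex, so p ≤ d; swapping the vertices at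
-- steps i and i + 1 changes the cost by at most p(i) − p(i + 1), so p is
-- non-increasing when σ is optimal.  Slicing p into levels ℓ_h = #{i : p(i) > h}
-- for h < d gives |E| = Σ ℓ_h, 2·MSVC = Σ ℓ_h (ℓ_h + 1), and u = Σ (ℓ_h − ⌊n/2⌋)⁺
-- edges left uncovered after ⌊n/2⌋ steps.  Since n d = 2|E| the levels average n/2,
-- and Cauchy–Schwarz gives
--   d Σ ℓ_h² − |E|² = d Σ (ℓ_h − n/2)² ≥ (Σ |ℓ_h − n/2|)² = 4 (Σ (ℓ_h − n/2)⁺)²,
-- that is |E|² + 4u² ≤ 2d·MSVC (for odd n the linear term Σ ℓ_h absorbs the parity,
-- using that the last step covers no edge).  Multiplying by n gives the claim.

module Submission where

open import Defs
open import Data.Nat using (ℕ; _+_; _*_; _∸_; _≤_; _<_)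
open import Data.Fin.Permutation using (Permutation′)
open import Data.Nat
open import Data.Nat.Properties
open import Data.Nat.Tactic.RingSolver using (solve-∀)
import Data.Nat.ListAction as List
open import Data.Bool using (if_then_else_)
open import Data.Fin using (Fin; zero; suc; toℕ; fromℕ<)
import Data.Fin as Fin
open import Data.Fin.Properties using (toℕ<n; toℕ-injective; toℕ-fromℕ<)
open import Data.Fin.Permutation using (_⟨$⟩ˡ_; _⟨$⟩ʳ_; inverseʳ; transpose; _∘ₚ_)
import Data.Fin.Permutation.Components as PC
open import Data.List using (List; []; _∷_; length; filter; map; lookup)
import Data.List.Relation.Unary.All as All
open import Data.List.Membership.Propositional.Properties using (∈-lookup)
open import Data.Product using (_,_; _×_; ∃-syntax; proj₁; proj₂; map₂)
open import Data.Sum using (inj₁; inj₂)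
open import Function using (_∘_)
open import Relation.Binary using (tri<; tri≈; tri>)
open import Relation.Binary.PropositionalEquality
open import Relation.Nullary using (Dec; yes; no; does; ¬_; contradiction)
open import Relation.Nullary.Decidable using (_⊎-dec_)
open import Relation.Unary using (Decidable)
open import Algebra.Properties.Semiring.Sum +-*-semiring
  using (sum; sum-syntax; ∑-comm; ∑-distrib-+; *-distribˡ-sum; sum-cong-≗)

𝟙 : ∀ {p} {P : Set p} → Dec P → ℕ
𝟙 P? = if does P? then 1 else 0

𝟙-yes : ∀ {p} {P : Set p} (P? : Dec P) → P → 𝟙 P? ≡ 1
𝟙-yes (yes _) _ = refl
𝟙-yes (no ¬p) p = contradiction p ¬p

𝟙-no : ∀ {p} {P : Set p} (P? : Dec P) → ¬ P → 𝟙 P? ≡ 0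
𝟙-no (yes p) ¬p = contradiction p ¬p
𝟙-no (no _)  _  = refl

𝟙≤1 : ∀ {p} {P : Set p} (P? : Dec P) → 𝟙 P? ≤ 1
𝟙≤1 (yes _) = ≤-refl
𝟙≤1 (no _)  = z≤n

𝟙-mono : ∀ {p q} {P : Set p} {Q : Set q} (P? : Dec P) (Q? : Dec Q) → (P → Q) → 𝟙 P? ≤ 𝟙 Q?
𝟙-mono (yes p) Q? P⇒Q = ≤-reflexive (sym (𝟙-yes Q? (P⇒Q p)))
𝟙-mono (no _)  Q? P⇒Q = z≤n

𝟙-cong : ∀ {p q} {P : Set p} {Q : Set q} (P? : Dec P) (Q? : Dec Q) → (P → Q) → (Q → P) → 𝟙 P? ≡ 𝟙 Q?
𝟙-cong P? Q? P⇒Q Q⇒P = ≤-antisym (𝟙-mono P? Q? P⇒Q) (𝟙-mono Q? P? Q⇒P)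

𝟙-⊎ : ∀ {p q} {P : Set p} {Q : Set q} (P? : Dec P) (Q? : Dec Q) → (P → ¬ Q) →
  𝟙 (P? ⊎-dec Q?) ≡ 𝟙 P? + 𝟙 Q?
𝟙-⊎ (yes p) (yes q) exclusive = contradiction q (exclusive p)
𝟙-⊎ (yes _) (no _)  _         = refl
𝟙-⊎ (no _)  (yes _) _         = refl
𝟙-⊎ (no _)  (no _)  _         = refl

∑-cong : ∀ {n} {f g : Fin n → ℕ} → (∀ i → f i ≡ g i) → sum f ≡ sum g
∑-cong = sum-cong-≗

∑-const : ∀ n x → ∑[ i < n ] x ≡ n * x
∑-const zero    x = refl
∑-const (suc n) x = cong (x +_) (∑-const n x)

∑-zero : ∀ n → ∑[ i < n ] 0 ≡ 0
∑-zero n = trans (∑-const n 0) (*-zeroʳ n)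

∑-mono-≤ : ∀ {n} {f g : Fin n → ℕ} → (∀ i → f i ≤ g i) → sum f ≤ sum g
∑-mono-≤ {zero}  f≤g = z≤n
∑-mono-≤ {suc n} f≤g = +-mono-≤ (f≤g zero) (∑-mono-≤ (f≤g ∘ suc))

∑-delta : ∀ {n} (w : ℕ → ℕ) {j} → j < n → ∑[ i < n ] (w (toℕ i) * 𝟙 (j ≟ toℕ i)) ≡ w j
∑-delta {suc n} w {zero} _ = begin
    w 0 * 1 + ∑[ i < n ] (w (suc (toℕ i)) * 𝟙 (0 ≟ suc (toℕ i)))
  ≡⟨ cong₂ _+_ (*-identityʳ (w 0)) (∑-cong {n} (λ i → cong (w (suc (toℕ i)) *_) (𝟙-no (0 ≟ suc (toℕ i)) λ ()))) ⟩
    w 0 + ∑[ i < n ] (w (suc (toℕ i)) * 0)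
  ≡⟨ cong (w 0 +_) (trans (∑-cong {n} (λ i → *-zeroʳ (w (suc (toℕ i))))) (∑-zero n)) ⟩
    w 0 + 0
  ≡⟨ +-identityʳ (w 0) ⟩
    w 0
  ∎
  where open ≡-Reasoning
∑-delta {suc n} w {suc j} (s≤s j<n) = begin
    w 0 * 𝟙 (suc j ≟ 0) + ∑[ i < n ] (w (suc (toℕ i)) * 𝟙 (suc j ≟ suc (toℕ i)))
  ≡⟨ cong₂ _+_ (cong (w 0 *_) (𝟙-no (suc j ≟ 0) λ ()))
       (∑-cong {n} (λ i → cong (w (suc (toℕ i)) *_) (𝟙-cong (suc j ≟ suc (toℕ i)) (j ≟ toℕ i) suc-injective (cong suc)))) ⟩
    w 0 * 0 + ∑[ i < n ] (w (suc (toℕ i)) * 𝟙 (j ≟ toℕ i))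
  ≡⟨ cong₂ _+_ (*-zeroʳ (w 0)) (∑-delta (w ∘ suc) j<n) ⟩
    w (suc j)
  ∎
  where open ≡-Reasoning

∑-𝟙≟ : ∀ {n} (u : Fin n) → ∑[ v < n ] 𝟙 (u Fin.≟ v) ≡ 1
∑-𝟙≟ {n} u = trans
  (∑-cong {n} (λ v → trans (𝟙-cong (u Fin.≟ v) (toℕ u ≟ toℕ v) (cong toℕ) toℕ-injective) (sym (*-identityˡ _))))
  (∑-delta (λ _ → 1) (toℕ<n u))

∑-prefix : ∀ {N} (w : ℕ → ℕ) {ℓ} → ℓ ≤ N →
  ∑[ i < N ] (w (toℕ i) * 𝟙 (toℕ i <? ℓ)) ≡ ∑[ j < ℓ ] w (toℕ j)
∑-prefix {N} w {zero} _ =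
  trans (∑-cong {N} (λ i → trans (cong (w (toℕ i) *_) (𝟙-no (toℕ i <? 0) λ ())) (*-zeroʳ (w (toℕ i)))))
        (∑-zero N)
∑-prefix {suc N} w {suc ℓ} (s≤s ℓ≤N) = cong₂ _+_
  (trans (cong (w 0 *_) (𝟙-yes (0 <? suc ℓ) z<s)) (*-identityʳ (w 0)))
  (trans (∑-cong {N} (λ i → cong (w (suc (toℕ i)) *_) (𝟙-cong (suc (toℕ i) <? suc ℓ) (toℕ i <? ℓ) s≤s⁻¹ s≤s)))
         (∑-prefix (w ∘ suc) ℓ≤N))

∑-𝟙< : ∀ {N ℓ} → ℓ ≤ N → ∑[ i < N ] 𝟙 (toℕ i <? ℓ) ≡ ℓ
∑-𝟙< {N} {ℓ} ℓ≤N = begin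
    ∑[ i < N ] 𝟙 (toℕ i <? ℓ)
  ≡⟨ ∑-cong {N} (λ i → sym (*-identityˡ _)) ⟩
    ∑[ i < N ] (1 * 𝟙 (toℕ i <? ℓ))
  ≡⟨ ∑-prefix (λ _ → 1) ℓ≤N ⟩
    ∑[ j < ℓ ] 1
  ≡⟨ trans (∑-const ℓ 1) (*-identityʳ ℓ) ⟩
    ℓ
  ∎
  where open ≡-Reasoning

-- Layer-cake decomposition of an antitone profile

count : ∀ {N} {P : Fin N → Set} → (∀ i → Dec (P i)) → ℕ
count {N} P? = ∑[ i < N ] 𝟙 (P? i)

count≤ : ∀ {N} {P : Fin N → Set} (P? : ∀ i → Dec (P i)) → count P? ≤ N
count≤ {N} P? = ≤-trans (∑-mono-≤ (𝟙≤1 ∘ P?)) (≤-reflexive (trans (∑-const N 1) (*-identityʳ N)))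

count-none : ∀ {N} {P : Fin N → Set} (P? : ∀ i → Dec (P i)) → (∀ i → ¬ P i) → count P? ≡ 0
count-none {N} P? none = trans (∑-cong {N} (λ i → 𝟙-no (P? i) (none i))) (∑-zero N)

DownClosed : ∀ {N} → (Fin N → Set) → Set
DownClosed P = ∀ {i j} → toℕ i ≤ toℕ j → P j → P i

downClosed⇒initialSegment : ∀ {N} {P : Fin N → Set} (P? : ∀ i → Dec (P i)) → DownClosed P →
  ∀ i → 𝟙 (P? i) ≡ 𝟙 (toℕ i <? count P?)
downClosed⇒initialSegment {suc N} P? closed i with P? zero
... | no ¬P₀ = trans (𝟙-no (P? i) (¬P₀ ∘ closed z≤n)) (sym (𝟙-no (toℕ i <? count (P? ∘ suc)) i≮0))
  where
  i≮0 : ¬ (toℕ i < count (P? ∘ suc))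
  i≮0 i<c = n≮0 (subst (toℕ i <_) (count-none (P? ∘ suc) (λ j → ¬P₀ ∘ closed z≤n)) i<c)
... | yes P₀ with i
...   | zero  = 𝟙-yes (P? zero) P₀
...   | suc i = trans (downClosed⇒initialSegment (P? ∘ suc) (closed ∘ s≤s) i)
                      (𝟙-cong (toℕ i <? count (P? ∘ suc)) (suc (toℕ i) <? suc (count (P? ∘ suc))) s≤s s≤s⁻¹)

Antitone : ∀ {N} → (Fin N → ℕ) → Set
Antitone f = ∀ {i j} → toℕ i ≤ toℕ j → f j ≤ f i

level : ∀ {N} → (Fin N → ℕ) → ℕ → ℕ
level f h = count (λ i → h <? f i)

layerCake : ∀ {N d} (f : Fin N → ℕ) (w : ℕ → ℕ) → (∀ i → f i ≤ d) → Antitone f →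
  ∑[ i < N ] (w (toℕ i) * f i) ≡ ∑[ h < d ] ∑[ j < level f (toℕ h) ] w (toℕ j)
layerCake {N} {d} f w f≤d antitone = begin
    ∑[ i < N ] (w (toℕ i) * f i)
  ≡⟨ ∑-cong {N} (λ i → cong (w (toℕ i) *_) (sym (∑-𝟙< (f≤d i)))) ⟩
    ∑[ i < N ] (w (toℕ i) * ∑[ h < d ] 𝟙 (toℕ h <? f i))
  ≡⟨ ∑-cong {N} (λ i → *-distribˡ-sum {d} (w (toℕ i)) (λ h → 𝟙 (toℕ h <? f i))) ⟩
    ∑[ i < N ] ∑[ h < d ] (w (toℕ i) * 𝟙 (toℕ h <? f i))
  ≡⟨ ∑-comm {N} {d} (λ i h → w (toℕ i) * 𝟙 (toℕ h <? f i)) ⟩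
    ∑[ h < d ] ∑[ i < N ] (w (toℕ i) * 𝟙 (toℕ h <? f i))
  ≡⟨ ∑-cong {d} (λ h → ∑-cong {N} (λ i → cong (w (toℕ i) *_)
       (downClosed⇒initialSegment (λ i → toℕ h <? f i) (λ i≤j h<fj → <-≤-trans h<fj (antitone i≤j)) i))) ⟩
    ∑[ h < d ] ∑[ i < N ] (w (toℕ i) * 𝟙 (toℕ i <? level f (toℕ h)))
  ≡⟨ ∑-cong {d} (λ h → ∑-prefix w (count≤ (λ i → toℕ h <? f i))) ⟩
    ∑[ h < d ] ∑[ j < level f (toℕ h) ] w (toℕ j)
  ∎
  where open ≡-Reasoning

2*∑[1+i]≡n*[1+n] : ∀ ℓ → 2 * ∑[ j < ℓ ] suc (toℕ j) ≡ ℓ * suc ℓ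
2*∑[1+i]≡n*[1+n] zero    = refl
2*∑[1+i]≡n*[1+n] (suc ℓ) = begin
    2 * (1 + ∑[ j < ℓ ] (1 + suc (toℕ j)))
  ≡⟨ cong (λ t → 2 * (1 + t)) (∑-distrib-+ {ℓ} (λ _ → 1) (λ j → suc (toℕ j))) ⟩
    2 * (1 + (∑[ j < ℓ ] 1 + s))
  ≡⟨ cong (λ t → 2 * (1 + (t + s))) (∑-const ℓ 1) ⟩
    2 * (1 + (ℓ * 1 + s))
  ≡⟨ expand ℓ s ⟩
    2 + 2 * ℓ + 2 * s
  ≡⟨ cong (2 + 2 * ℓ +_) (2*∑[1+i]≡n*[1+n] ℓ) ⟩
    2 + 2 * ℓ + ℓ * suc ℓ
  ≡⟨ collect ℓ ⟩
    suc ℓ * suc (suc ℓ)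
  ∎
  where
  open ≡-Reasoning
  s = ∑[ j < ℓ ] suc (toℕ j)
  expand : ∀ ℓ s → 2 * (1 + (ℓ * 1 + s)) ≡ 2 + 2 * ℓ + 2 * s
  expand = solve-∀
  collect : ∀ ℓ → 2 + 2 * ℓ + ℓ * suc ℓ ≡ suc ℓ * suc (suc ℓ)
  collect = solve-∀

∑-𝟙<-⊓ : ∀ ℓ k → ∑[ j < ℓ ] 𝟙 (toℕ j <? k) ≡ ℓ ⊓ k
∑-𝟙<-⊓ ℓ k = trans
  (∑-cong {ℓ} (λ j → 𝟙-cong (toℕ j <? k) (toℕ j <? ℓ ⊓ k)
     (⊓-glb (toℕ<n j)) (λ j<ℓ⊓k → <-≤-trans j<ℓ⊓k (m⊓n≤n ℓ k))))
  (∑-𝟙< (m⊓n≤m ℓ k))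

-- The bound for the levels

private
  2*m*n≤m*m+n*n-≤ : ∀ {m n} → m ≤ n → 2 * m * n ≤ m * m + n * n
  2*m*n≤m*m+n*n-≤ {m} m≤n with t , refl ← m≤n⇒∃[o]m+o≡n m≤n =
    subst₂ _≤_ (identity₁ m t) (sym (identity₂ m t)) (m≤m+n _ (t * t))
    where
    identity₁ : ∀ m t → 2 * m * m + 2 * m * t ≡ 2 * m * (m + t)
    identity₁ = solve-∀
    identity₂ : ∀ m t → m * m + (m + t) * (m + t) ≡ 2 * m * m + 2 * m * t + t * t
    identity₂ = solve-∀

2*m*n≤m*m+n*n : ∀ m n → 2 * m * n ≤ m * m + n * n
2*m*n≤m*m+n*n m n with ≤-total m n
... | inj₁ m≤n = 2*m*n≤m*m+n*n-≤ m≤n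
... | inj₂ n≤m = subst₂ _≤_ (swap n m) (+-comm (n * n) (m * m)) (2*m*n≤m*m+n*n-≤ n≤m)
  where
  swap : ∀ n m → 2 * n * m ≡ 2 * m * n
  swap = solve-∀

cauchySchwarz : ∀ {n} (a : Fin n → ℕ) → sum a * sum a ≤ n * ∑[ i < n ] (a i * a i)
cauchySchwarz {zero}  a = z≤n
cauchySchwarz {suc n} a = begin
    (x + s) * (x + s)
  ≡⟨ square x s ⟩
    x * x + 2 * x * s + s * s
  ≤⟨ +-mono-≤ (+-monoʳ-≤ (x * x) cross) (cauchySchwarz (a ∘ suc)) ⟩
    x * x + (n * (x * x) + q) + n * q
  ≡⟨ regroup x n q ⟩
    suc n * (x * x + q)
  ∎
  where
  open ≤-Reasoning
  x = a zero
  s = sum (a ∘ suc)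
  q = ∑[ i < n ] (a (suc i) * a (suc i))
  square : ∀ x s → (x + s) * (x + s) ≡ x * x + 2 * x * s + s * s
  square = solve-∀
  regroup : ∀ x n q → x * x + (n * (x * x) + q) + n * q ≡ suc n * (x * x + q)
  regroup = solve-∀
  cross : 2 * x * s ≤ n * (x * x) + q
  cross = begin
      2 * x * s
    ≡⟨ *-distribˡ-sum (2 * x) (a ∘ suc) ⟩
      ∑[ i < n ] (2 * x * a (suc i))
    ≤⟨ ∑-mono-≤ (λ i → 2*m*n≤m*m+n*n x (a (suc i))) ⟩
      ∑[ i < n ] (x * x + a (suc i) * a (suc i))
    ≡⟨ ∑-distrib-+ (λ _ → x * x) (λ i → a (suc i) * a (suc i)) ⟩
      ∑[ i < n ] (x * x) + q
    ≡⟨ cong (_+ q) (∑-const n (x * x)) ⟩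
      n * (x * x) + q
    ∎

private
  ∣k+t-k∣≡t : ∀ k t → ∣ k + t - k ∣ ≡ t
  ∣k+t-k∣≡t k t = trans (∣-∣-comm (k + t) k) (∣m-m+n∣≡n k t)

x*x+k*k≡∣x-k∣²+2*k*x : ∀ x k → x * x + k * k ≡ ∣ x - k ∣ * ∣ x - k ∣ + 2 * k * x
x*x+k*k≡∣x-k∣²+2*k*x x k with ≤-total k x
... | inj₁ k≤x with t , refl ← m≤n⇒∃[o]m+o≡n k≤x rewrite ∣k+t-k∣≡t k t = identity k t
  where
  identity : ∀ k t → (k + t) * (k + t) + k * k ≡ t * t + 2 * k * (k + t)
  identity = solve-∀
... | inj₂ x≤k with t , refl ← m≤n⇒∃[o]m+o≡n x≤k rewrite ∣m-m+n∣≡n x t = identity x t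
  where
  identity : ∀ x t → x * x + (x + t) * (x + t) ≡ t * t + 2 * (x + t) * x
  identity = solve-∀

2*[x∸k]+k≡∣x-k∣+x : ∀ x k → 2 * (x ∸ k) + k ≡ ∣ x - k ∣ + x
2*[x∸k]+k≡∣x-k∣+x x k with ≤-total k x
... | inj₁ k≤x with t , refl ← m≤n⇒∃[o]m+o≡n k≤x rewrite ∣k+t-k∣≡t k t | m+n∸m≡n k t = identity k t
  where
  identity : ∀ k t → 2 * t + k ≡ t + (k + t)
  identity = solve-∀
... | inj₂ x≤k with t , refl ← m≤n⇒∃[o]m+o≡n x≤k rewrite ∣m-m+n∣≡n x t | m≤n⇒m∸n≡0 (m≤m+n x t) = +-comm x t

∣x-k∣≤k : ∀ {x} k → x ≤ k + k → ∣ x - k ∣ ≤ k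
∣x-k∣≤k {x} k x≤2k with ≤-total k x
... | inj₁ k≤x with t , refl ← m≤n⇒∃[o]m+o≡n k≤x rewrite ∣k+t-k∣≡t k t = +-cancelˡ-≤ k t k x≤2k
... | inj₂ x≤k with t , refl ← m≤n⇒∃[o]m+o≡n x≤k rewrite ∣m-m+n∣≡n x t = m≤n+m t x

-- With L2 = Σ ℓ², Q = Σ (ℓ − k)², A = Σ |ℓ − k|, P = Σ (ℓ − k)⁺ and m = k d + D, the
-- hypotheses say d L2 = m² − D² + d Q and 2P = A + D; then A² ≤ d Q and
-- 2D (A + D) ≤ d m conclude.
private
  level-moments-bound : ∀ d k D L2 Q A P →
    L2 + d * (k * k) ≡ Q + 2 * k * (k * d + D) →
    2 * P + d * k ≡ A + (k * d + D) →
    A * A ≤ d * Q → A ≤ d * k → 2 * D ≤ d →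
    (k * d + D) * (k * d + D) + 4 * (P * P) ≤ d * ((k * d + D) + L2)
  level-moments-bound d k D L2 Q A P squares excess A²≤dQ A≤dk 2D≤d =
    +-cancelʳ-≤ (d * (d * (k * k))) _ _ (begin
        m * m + 4 * (P * P) + d * (d * (k * k))
      ≡⟨ cong (λ t → m * m + t + d * (d * (k * k))) 4P²≡[A+D]² ⟩
        m * m + (A + D) * (A + D) + d * (d * (k * k))
      ≡⟨ expand d k D A ⟩
        A * A + 2 * D * (A + D) + d * (2 * k * m)
      ≤⟨ +-monoˡ-≤ (d * (2 * k * m)) (+-mono-≤ A²≤dQ (*-mono-≤ 2D≤d A+D≤m)) ⟩
        d * Q + d * m + d * (2 * k * m)
      ≡⟨ collect d Q m k ⟩
        d * (m + (Q + 2 * k * m))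
      ≡⟨ cong (λ t → d * (m + t)) (sym squares) ⟩
        d * (m + (L2 + d * (k * k)))
      ≡⟨ regroup d m L2 k ⟩
        d * (m + L2) + d * (d * (k * k))
      ∎)
    where
    open ≤-Reasoning
    m = k * d + D
    2P≡A+D : 2 * P ≡ A + D
    2P≡A+D = +-cancelʳ-≡ (d * k) _ _ (trans excess (rearrange A k d D))
      where
      rearrange : ∀ A k d D → A + (k * d + D) ≡ A + D + d * k
      rearrange = solve-∀
    4P²≡[A+D]² : 4 * (P * P) ≡ (A + D) * (A + D)
    4P²≡[A+D]² = trans (square-double P) (cong (λ t → t * t) 2P≡A+D)
      where
      square-double : ∀ P → 4 * (P * P) ≡ (2 * P) * (2 * P)
      square-double = solve-∀
    A+D≤m : A + D ≤ m
    A+D≤m = +-monoˡ-≤ D (≤-trans A≤dk (≤-reflexive (*-comm d k)))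
    expand : ∀ d k D A → (k * d + D) * (k * d + D) + (A + D) * (A + D) + d * (d * (k * k))
                         ≡ A * A + 2 * D * (A + D) + d * (2 * k * (k * d + D))
    expand = solve-∀
    collect : ∀ d Q m k → d * Q + d * m + d * (2 * k * m) ≡ d * (m + (Q + 2 * k * m))
    collect = solve-∀
    regroup : ∀ d m L2 k → d * (m + (L2 + d * (k * k))) ≡ d * (m + L2) + d * (d * (k * k))
    regroup = solve-∀

levels-bound : ∀ {d} k D (ℓ : Fin d → ℕ) → (∀ h → ℓ h ≤ k + k) → sum ℓ ≡ k * d + D → 2 * D ≤ d →
  sum ℓ * sum ℓ + 4 * (∑[ h < d ] (ℓ h ∸ k) * ∑[ h < d ] (ℓ h ∸ k))
    ≤ d * ∑[ h < d ] (ℓ h * suc (ℓ h))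
levels-bound {d} k D ℓ ℓ≤2k m≡kd+D 2D≤d = subst₂ _≤_
  (cong (λ m → m * m + 4 * (P * P)) (sym m≡kd+D))
  (cong (d *_) (trans (cong (_+ L2) (sym m≡kd+D)) (sym ∑ℓ[1+ℓ])))
  (level-moments-bound d k D L2 Q A P squares excess (cauchySchwarz dist) A≤dk 2D≤d)
  where
  open ≡-Reasoning
  dist : Fin d → ℕ
  dist h = ∣ ℓ h - k ∣
  L2 = ∑[ h < d ] (ℓ h * ℓ h)
  Q  = ∑[ h < d ] (dist h * dist h)
  A  = sum dist
  P  = ∑[ h < d ] (ℓ h ∸ k)
  ∑ℓ[1+ℓ] : ∑[ h < d ] (ℓ h * suc (ℓ h)) ≡ sum ℓ + L2
  ∑ℓ[1+ℓ] = trans (∑-cong {d} (λ h → *-suc (ℓ h) (ℓ h))) (∑-distrib-+ ℓ (λ h → ℓ h * ℓ h))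
  squares : L2 + d * (k * k) ≡ Q + 2 * k * (k * d + D)
  squares = begin
      L2 + d * (k * k)
    ≡⟨ cong (L2 +_) (sym (∑-const d (k * k))) ⟩
      L2 + ∑[ h < d ] (k * k)
    ≡⟨ sym (∑-distrib-+ (λ h → ℓ h * ℓ h) (λ _ → k * k)) ⟩
      ∑[ h < d ] (ℓ h * ℓ h + k * k)
    ≡⟨ ∑-cong {d} (λ h → x*x+k*k≡∣x-k∣²+2*k*x (ℓ h) k) ⟩
      ∑[ h < d ] (dist h * dist h + 2 * k * ℓ h)
    ≡⟨ ∑-distrib-+ (λ h → dist h * dist h) (λ h → 2 * k * ℓ h) ⟩
      Q + ∑[ h < d ] (2 * k * ℓ h)
    ≡⟨ cong (Q +_) (sym (*-distribˡ-sum (2 * k) ℓ)) ⟩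
      Q + 2 * k * sum ℓ
    ≡⟨ cong (λ m → Q + 2 * k * m) m≡kd+D ⟩
      Q + 2 * k * (k * d + D)
    ∎
  excess : 2 * P + d * k ≡ A + (k * d + D)
  excess = begin
      2 * P + d * k
    ≡⟨ cong₂ _+_ (*-distribˡ-sum 2 (λ h → ℓ h ∸ k)) (sym (∑-const d k)) ⟩
      ∑[ h < d ] (2 * (ℓ h ∸ k)) + ∑[ h < d ] k
    ≡⟨ sym (∑-distrib-+ (λ h → 2 * (ℓ h ∸ k)) (λ _ → k)) ⟩
      ∑[ h < d ] (2 * (ℓ h ∸ k) + k)
    ≡⟨ ∑-cong {d} (λ h → 2*[x∸k]+k≡∣x-k∣+x (ℓ h) k) ⟩
      ∑[ h < d ] (dist h + ℓ h)
    ≡⟨ ∑-distrib-+ dist ℓ ⟩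
      A + sum ℓ
    ≡⟨ cong (A +_) m≡kd+D ⟩
      A + (k * d + D)
    ∎
  A≤dk : A ≤ d * k
  A≤dk = ≤-trans (∑-mono-≤ (λ h → ∣x-k∣≤k k (ℓ≤2k h))) (≤-reflexive (∑-const d k))

profile-bound : ∀ {d} k D (f : Fin (k + k) → ℕ) → (∀ i → f i ≤ d) → Antitone f →
  sum f ≡ k * d + D → 2 * D ≤ d →
  let c = ∑[ i < k + k ] (𝟙 (toℕ i <? k) * f i) in
  sum f * sum f + 4 * ((sum f ∸ c) * (sum f ∸ c)) ≤ d * (2 * ∑[ i < k + k ] (suc (toℕ i) * f i))
profile-bound {d} k D f f≤d antitone m≡kd+D 2D≤d = subst₂ _≤_
  (cong₂ (λ m u → m * m + 4 * (u * u)) (sym m≡∑ℓ) (sym m∸c≡∑[ℓ∸k]))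
  (cong (d *_) (sym 2S≡∑ℓ[1+ℓ]))
  (levels-bound k D ℓ (λ h → count≤ (λ i → toℕ h <? f i)) (trans (sym m≡∑ℓ) m≡kd+D) 2D≤d)
  where
  N = k + k
  ℓ : Fin d → ℕ
  ℓ h = level f (toℕ h)
  c = ∑[ i < N ] (𝟙 (toℕ i <? k) * f i)
  m≡∑ℓ : sum f ≡ sum ℓ
  m≡∑ℓ = begin
      sum f
    ≡⟨ ∑-cong {N} (λ i → sym (*-identityˡ (f i))) ⟩
      ∑[ i < N ] (1 * f i)
    ≡⟨ layerCake f (λ _ → 1) f≤d antitone ⟩
      ∑[ h < d ] ∑[ j < ℓ h ] 1
    ≡⟨ ∑-cong {d} (λ h → trans (∑-const (ℓ h) 1) (*-identityʳ (ℓ h))) ⟩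
      sum ℓ
    ∎
    where open ≡-Reasoning
  2S≡∑ℓ[1+ℓ] : 2 * ∑[ i < N ] (suc (toℕ i) * f i) ≡ ∑[ h < d ] (ℓ h * suc (ℓ h))
  2S≡∑ℓ[1+ℓ] = begin
      2 * ∑[ i < N ] (suc (toℕ i) * f i)
    ≡⟨ cong (2 *_) (layerCake f suc f≤d antitone) ⟩
      2 * ∑[ h < d ] ∑[ j < ℓ h ] suc (toℕ j)
    ≡⟨ *-distribˡ-sum 2 (λ h → ∑[ j < ℓ h ] suc (toℕ j)) ⟩
      ∑[ h < d ] (2 * ∑[ j < ℓ h ] suc (toℕ j))
    ≡⟨ ∑-cong {d} (λ h → 2*∑[1+i]≡n*[1+n] (ℓ h)) ⟩
      ∑[ h < d ] (ℓ h * suc (ℓ h))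
    ∎
    where open ≡-Reasoning
  c≡∑[ℓ⊓k] : c ≡ ∑[ h < d ] (ℓ h ⊓ k)
  c≡∑[ℓ⊓k] = trans (layerCake f (λ j → 𝟙 (j <? k)) f≤d antitone) (∑-cong {d} (λ h → ∑-𝟙<-⊓ (ℓ h) k))
  m∸c≡∑[ℓ∸k] : sum f ∸ c ≡ ∑[ h < d ] (ℓ h ∸ k)
  m∸c≡∑[ℓ∸k] = begin
      sum f ∸ c
    ≡⟨ cong₂ _∸_ m≡∑ℓ c≡∑[ℓ⊓k] ⟩
      sum ℓ ∸ ∑[ h < d ] (ℓ h ⊓ k)
    ≡⟨ cong (_∸ ∑[ h < d ] (ℓ h ⊓ k)) (∑-cong {d} (λ h → sym (split h))) ⟩
      ∑[ h < d ] (ℓ h ⊓ k + (ℓ h ∸ k)) ∸ ∑[ h < d ] (ℓ h ⊓ k)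
    ≡⟨ cong (_∸ ∑[ h < d ] (ℓ h ⊓ k)) (∑-distrib-+ (λ h → ℓ h ⊓ k) (λ h → ℓ h ∸ k)) ⟩
      ∑[ h < d ] (ℓ h ⊓ k) + ∑[ h < d ] (ℓ h ∸ k) ∸ ∑[ h < d ] (ℓ h ⊓ k)
    ≡⟨ m+n∸m≡n (∑[ h < d ] (ℓ h ⊓ k)) _ ⟩
      ∑[ h < d ] (ℓ h ∸ k)
    ∎
    where
    open ≡-Reasoning
    split : ∀ h → ℓ h ⊓ k + (ℓ h ∸ k) ≡ ℓ h
    split h = trans (cong (_+ (ℓ h ∸ k)) (⊓-comm (ℓ h) k)) (m⊓n+n∸m≡n k (ℓ h))

data Halves (n k : ℕ) : Set where
  even : n ≡ k + k → Halves n k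
  odd  : n ≡ suc (k + k) → Halves n k

halves : ∀ n → Halves n ⌊ n /2⌋
halves zero          = even refl
halves (suc zero)    = odd refl
halves (suc (suc n)) with halves n
... | even n≡2k  = even (cong suc (trans (cong suc n≡2k) (sym (+-suc ⌊ n /2⌋ ⌊ n /2⌋))))
... | odd n≡2k+1 = odd (cong suc (trans (cong suc n≡2k+1) (cong suc (sym (+-suc ⌊ n /2⌋ ⌊ n /2⌋)))))

halves-≤ : ∀ {n k} → Halves n k → k + k ≤ n
halves-≤ (even refl) = ≤-refl
halves-≤ (odd refl) = n≤1+n _

halves-≥ : ∀ {n k} → Halves n k → n ≤ suc (k + k)
halves-≥ (even refl) = n≤1+n _
halves-≥ (odd refl) = ≤-refl

2*[1+i]≤n⇒i<k : ∀ {n k i} → Halves n k → 2 * suc i ≤ n → i < k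
2*[1+i]≤n⇒i<k {n} {k} {i} halves 2[1+i]≤n with i <? k
... | yes i<k = i<k
... | no i≮k = contradiction
  (≤-trans (≤-trans (≤-reflexive (sym (double-suc k))) (*-monoʳ-≤ 2 (s≤s (≮⇒≥ i≮k)))) (≤-trans 2[1+i]≤n (halves-≥ halves)))
  (1+n≰n {suc (k + k)})
  where
  double-suc : ∀ k → 2 * suc k ≡ suc (suc (k + k))
  double-suc = solve-∀

i<k⇒2*[1+i]≤n : ∀ {n k i} → Halves n k → i < k → 2 * suc i ≤ n
i<k⇒2*[1+i]≤n {k = k} halves i<k = ≤-trans (*-monoʳ-≤ 2 i<k) (≤-trans (≤-reflexive (double k)) (halves-≤ halves))
  where
  double : ∀ k → 2 * k ≡ k + k
  double = solve-∀

private
  half-excess : ∀ x d m → 2 * x + d ≡ 2 * m → ∃[ D ] m ≡ x + D × 2 * D ≡ d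
  half-excess x d m eq with D , refl ← m≤n⇒∃[o]m+o≡n {x} {m} (*-cancelˡ-≤ 2 (≤-trans (m≤m+n (2 * x) d) (≤-reflexive eq))) =
    D , refl , sym (+-cancelˡ-≡ (2 * x) _ _ (trans eq (*-distribˡ-+ 2 x D)))

half-product : ∀ {n k d m} → Halves n k → n * d ≡ 2 * m → ∃[ D ] m ≡ k * d + D × 2 * D ≤ d
half-product {k = k} {d} {m} (even refl) nd≡2m =
  0 , *-cancelˡ-≡ m (k * d + 0) 2 (trans (sym nd≡2m) (identity k d)) , z≤n
  where
  identity : ∀ k d → (k + k) * d ≡ 2 * (k * d + 0)
  identity = solve-∀
half-product {k = k} {d} {m} (odd refl) nd≡2m =
  map₂ (map₂ ≤-reflexive) (half-excess (k * d) d m (trans (identity k d) nd≡2m))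
  where
  identity : ∀ k d → 2 * (k * d) + d ≡ suc (k + k) * d
  identity = solve-∀

rescale-bound : ∀ n d m S u → n * d ≡ 2 * m → m * m + 4 * (u * u) ≤ d * (2 * S) →
  4 * n * (u * u) ≤ (4 * S ∸ m * n) * m
rescale-bound n d m S u nd≡2m bound = begin
    4 * n * (u * u)
  ≤⟨ m+n≤o⇒m≤o∸n (4 * n * (u * u)) scaled ⟩
    4 * S * m ∸ m * n * m
  ≡⟨ sym (*-distribʳ-∸ m (4 * S) (m * n)) ⟩
    (4 * S ∸ m * n) * m
  ∎
  where
  open ≤-Reasoning
  scaled : 4 * n * (u * u) + m * n * m ≤ 4 * S * m
  scaled = begin
      4 * n * (u * u) + m * n * m
    ≡⟨ expand n m u ⟩
      n * (m * m + 4 * (u * u))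
    ≤⟨ *-monoʳ-≤ n bound ⟩
      n * (d * (2 * S))
    ≡⟨ sym (*-assoc n d (2 * S)) ⟩
      n * d * (2 * S)
    ≡⟨ cong (_* (2 * S)) nd≡2m ⟩
      2 * m * (2 * S)
    ≡⟨ collect m S ⟩
      4 * S * m
    ∎
    where
    expand : ∀ n m u → 4 * n * (u * u) + m * n * m ≡ n * (m * m + 4 * (u * u))
    expand = solve-∀
    collect : ∀ m S → 2 * m * (2 * S) ≡ 4 * S * m
    collect = solve-∀

-- The profile of an ordering

sum-map≡∑-lookup : ∀ {A : Set} (f : A → ℕ) (xs : List A) →
  List.sum (map f xs) ≡ ∑[ j < length xs ] f (lookup xs j)
sum-map≡∑-lookup f []       = refl
sum-map≡∑-lookup f (x ∷ xs) = cong (f x +_) (sum-map≡∑-lookup f xs)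

length-filter≡∑𝟙 : ∀ {A : Set} {P : A → Set} (P? : Decidable P) (xs : List A) →
  length (filter P? xs) ≡ ∑[ j < length xs ] 𝟙 (P? (lookup xs j))
length-filter≡∑𝟙 P? []       = refl
length-filter≡∑𝟙 P? (x ∷ xs) with P? x
... | yes _ = cong suc (length-filter≡∑𝟙 P? xs)
... | no _  = length-filter≡∑𝟙 P? xs

module _ {n} (G : Graph n) where

  edgeAt : Fin (numEdges G) → Fin n × Fin n
  edgeAt = lookup (edges G)

  edgeAt-ordered : ∀ j → toℕ (proj₁ (edgeAt j)) < toℕ (proj₂ (edgeAt j))
  edgeAt-ordered j = All.lookup (ordered G) (∈-lookup j)

firstPosition : ∀ {n} → Permutation′ n → Fin n × Fin n → ℕ
firstPosition σ (u , v) = toℕ (σ ⟨$⟩ˡ u) ⊓ toℕ (σ ⟨$⟩ˡ v)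

coverTime≡suc-firstPosition : ∀ {n} (σ : Permutation′ n) e → coverTime σ e ≡ suc (firstPosition σ e)
coverTime≡suc-firstPosition σ (u , v) = refl

profile : ∀ {n} → Graph n → Permutation′ n → ℕ → ℕ
profile G σ i = ∑[ j < numEdges G ] 𝟙 (firstPosition σ (edgeAt G j) ≟ i)

suc[x⊓y]<n : ∀ {x y n} → x ≢ y → x < n → y < n → suc (x ⊓ y) < n
suc[x⊓y]<n {x} {y} x≢y x<n y<n with <-cmp x y
... | tri< x<y _ _ rewrite m≤n⇒m⊓n≡m (<⇒≤ x<y) = ≤-<-trans x<y y<n
... | tri≈ _ x≡y _ = contradiction x≡y x≢y
... | tri> _ _ y<x rewrite m≥n⇒m⊓n≡n (<⇒≤ y<x) = ≤-<-trans y<x x<n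

suc-firstPosition<n : ∀ {n} (σ : Permutation′ n) {u v} → u ≢ v → suc (firstPosition σ (u , v)) < n
suc-firstPosition<n σ {u} {v} u≢v = suc[x⊓y]<n positions-differ (toℕ<n (σ ⟨$⟩ˡ u)) (toℕ<n (σ ⟨$⟩ˡ v))
  where
  positions-differ : toℕ (σ ⟨$⟩ˡ u) ≢ toℕ (σ ⟨$⟩ˡ v)
  positions-differ eq = u≢v (trans (sym (inverseʳ σ)) (trans (cong (σ ⟨$⟩ʳ_) (toℕ-injective eq)) (inverseʳ σ)))

profile-formula : ∀ {n N} (G : Graph n) (σ : Permutation′ n) →
  (∀ j → firstPosition σ (edgeAt G j) < N) → (w : ℕ → ℕ) →
  ∑[ j < numEdges G ] w (firstPosition σ (edgeAt G j)) ≡ ∑[ i < N ] (w (toℕ i) * profile G σ (toℕ i))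
profile-formula {N = N} G σ bounded w = begin
    ∑[ j < m ] w (firstAt j)
  ≡⟨ ∑-cong {m} (λ j → sym (∑-delta w (bounded j))) ⟩
    ∑[ j < m ] ∑[ i < N ] (w (toℕ i) * 𝟙 (firstAt j ≟ toℕ i))
  ≡⟨ ∑-comm {m} {N} (λ j i → w (toℕ i) * 𝟙 (firstAt j ≟ toℕ i)) ⟩
    ∑[ i < N ] ∑[ j < m ] (w (toℕ i) * 𝟙 (firstAt j ≟ toℕ i))
  ≡⟨ ∑-cong {N} (λ i → sym (*-distribˡ-sum (w (toℕ i)) (λ j → 𝟙 (firstAt j ≟ toℕ i)))) ⟩
    ∑[ i < N ] (w (toℕ i) * profile G σ (toℕ i))
  ∎
  where
  open ≡-Reasoning
  m = numEdges G
  firstAt : Fin m → ℕ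
  firstAt j = firstPosition σ (edgeAt G j)

degree≡∑𝟙 : ∀ {n} (G : Graph n) v → degree G v ≡ ∑[ j < numEdges G ] 𝟙 (incident? v (edgeAt G j))
degree≡∑𝟙 G v = length-filter≡∑𝟙 (incident? v) (edges G)

vertexAt-position : ∀ {n} (σ : Permutation′ n) {i} (i<n : i < n) {w} →
  toℕ (σ ⟨$⟩ˡ w) ≡ i → w ≡ σ ⟨$⟩ʳ fromℕ< i<n
vertexAt-position σ i<n eq =
  trans (sym (inverseʳ σ)) (cong (σ ⟨$⟩ʳ_) (toℕ-injective (trans eq (sym (toℕ-fromℕ< i<n)))))

firstPosition≡⇒incident : ∀ {n} (σ : Permutation′ n) {i} (i<n : i < n) e →
  firstPosition σ e ≡ i → Incident (σ ⟨$⟩ʳ fromℕ< i<n) e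
firstPosition≡⇒incident σ i<n (u , v) first≡i with ⊓-sel (toℕ (σ ⟨$⟩ˡ u)) (toℕ (σ ⟨$⟩ˡ v))
... | inj₁ first≡u = inj₁ (vertexAt-position σ i<n (trans (sym first≡u) first≡i))
... | inj₂ first≡v = inj₂ (vertexAt-position σ i<n (trans (sym first≡v) first≡i))

profile≤degree : ∀ {n} (G : Graph n) (σ : Permutation′ n) {i} (i<n : i < n) →
  profile G σ i ≤ degree G (σ ⟨$⟩ʳ fromℕ< i<n)
profile≤degree G σ {i} i<n = ≤-trans
  (∑-mono-≤ (λ j → 𝟙-mono (firstPosition σ (edgeAt G j) ≟ i) (incident? _ (edgeAt G j))
                          (firstPosition≡⇒incident σ i<n (edgeAt G j))))
  (≤-reflexive (sym (degree≡∑𝟙 G _)))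

∑-incident≡2 : ∀ {n} {u v : Fin n} → toℕ u < toℕ v → ∑[ w < n ] 𝟙 (incident? w (u , v)) ≡ 2
∑-incident≡2 {n} {u} {v} u<v = begin
    ∑[ w < n ] 𝟙 (incident? w (u , v))
  ≡⟨ ∑-cong {n} (λ w → 𝟙-⊎ (u Fin.≟ w) (v Fin.≟ w) (λ { refl refl → <-irrefl refl u<v })) ⟩
    ∑[ w < n ] (𝟙 (u Fin.≟ w) + 𝟙 (v Fin.≟ w))
  ≡⟨ ∑-distrib-+ (λ w → 𝟙 (u Fin.≟ w)) (λ w → 𝟙 (v Fin.≟ w)) ⟩
    ∑[ w < n ] 𝟙 (u Fin.≟ w) + ∑[ w < n ] 𝟙 (v Fin.≟ w)
  ≡⟨ cong₂ _+_ (∑-𝟙≟ u) (∑-𝟙≟ v) ⟩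
    2
  ∎
  where open ≡-Reasoning

handshake : ∀ {n} (G : Graph n) {d} → (∀ v → degree G v ≡ d) → n * d ≡ 2 * numEdges G
handshake {n} G {d} regular = begin
    n * d
  ≡⟨ sym (∑-const n d) ⟩
    ∑[ v < n ] d
  ≡⟨ ∑-cong {n} (λ v → trans (sym (regular v)) (degree≡∑𝟙 G v)) ⟩
    ∑[ v < n ] ∑[ j < m ] 𝟙 (incident? v (edgeAt G j))
  ≡⟨ ∑-comm {n} {m} (λ v j → 𝟙 (incident? v (edgeAt G j))) ⟩
    ∑[ j < m ] ∑[ v < n ] 𝟙 (incident? v (edgeAt G j))
  ≡⟨ ∑-cong {m} (λ j → ∑-incident≡2 (edgeAt-ordered G j)) ⟩
    ∑[ j < m ] 2
  ≡⟨ trans (∑-const m 2) (*-comm m 2) ⟩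
    2 * m
  ∎
  where
  open ≡-Reasoning
  m = numEdges G

transpose-shift : ∀ {n i} (i<n : i < n) (si<n : suc i < n) (z : Fin n) →
  toℕ (PC.transpose (fromℕ< si<n) (fromℕ< i<n) z) + 𝟙 (toℕ z ≟ suc i) ≤ toℕ z + 𝟙 (toℕ z ≟ i)
transpose-shift {i = i} i<n si<n z with z Fin.≟ fromℕ< si<n
... | yes refl rewrite toℕ-fromℕ< si<n | toℕ-fromℕ< i<n
      | 𝟙-yes (suc i ≟ suc i) refl = ≤-trans (≤-reflexive (+-comm i 1)) (m≤m+n (suc i) _)
... | no z≢J with z Fin.≟ fromℕ< i<n
...   | yes refl rewrite toℕ-fromℕ< si<n | toℕ-fromℕ< i<n
        | 𝟙-no (i ≟ suc i) (<⇒≢ (n<1+n i)) | 𝟙-yes (i ≟ i) refl = ≤-reflexive (trans (+-identityʳ (suc i)) (+-comm 1 i))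
...   | no _ rewrite 𝟙-no (toℕ z ≟ suc i) (λ eq → z≢J (toℕ-injective (trans eq (sym (toℕ-fromℕ< si<n)))))
        = +-monoʳ-≤ (toℕ z) z≤n

⊓-shift : ∀ {x y x′ y′} i j →
  x′ + 𝟙 (x ≟ j) ≤ x + 𝟙 (x ≟ i) → y′ + 𝟙 (y ≟ j) ≤ y + 𝟙 (y ≟ i) →
  x′ ⊓ y′ + 𝟙 (x ⊓ y ≟ j) ≤ x ⊓ y + 𝟙 (x ⊓ y ≟ i)
⊓-shift {x} {y} {x′} {y′} i j x-shift y-shift with ⊓-sel x y
... | inj₁ x⊓y≡x rewrite x⊓y≡x = ≤-trans (+-monoˡ-≤ (𝟙 (x ≟ j)) (m⊓n≤m x′ y′)) x-shift
... | inj₂ x⊓y≡y rewrite x⊓y≡y = ≤-trans (+-monoˡ-≤ (𝟙 (y ≟ j)) (m⊓n≤n x′ y′)) y-shift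

SVC≡∑suc-firstPosition : ∀ {n} (G : Graph n) (σ : Permutation′ n) →
  SVC G σ ≡ ∑[ j < numEdges G ] suc (firstPosition σ (edgeAt G j))
SVC≡∑suc-firstPosition G σ = trans (sum-map≡∑-lookup (coverTime σ) (edges G))
  (∑-cong {numEdges G} (λ j → coverTime≡suc-firstPosition σ (edgeAt G j)))

-- Swapping the vertices at positions i and i + 1 moves every edge first covered at
-- i + 1 one step earlier and no edge more than one step later.
profile-step : ∀ {n} (G : Graph n) (σ : Permutation′ n) → Optimal G σ →
  ∀ {i} → suc i < n → profile G σ (suc i) ≤ profile G σ i
profile-step {n} G σ optimal {i} si<n = +-cancelˡ-≤ (total σ) _ _ (begin
    total σ + profile G σ (suc i)
  ≤⟨ +-monoˡ-≤ (profile G σ (suc i)) (+-cancelˡ-≤ m _ _ σ≤τ) ⟩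
    total τ + profile G σ (suc i)
  ≡⟨ sym (∑-distrib-+ (first τ) (λ j → 𝟙 (first σ j ≟ suc i))) ⟩
    ∑[ j < m ] (first τ j + 𝟙 (first σ j ≟ suc i))
  ≤⟨ ∑-mono-≤ (λ j → edge-shift (edgeAt G j)) ⟩
    ∑[ j < m ] (first σ j + 𝟙 (first σ j ≟ i))
  ≡⟨ ∑-distrib-+ (first σ) (λ j → 𝟙 (first σ j ≟ i)) ⟩
    total σ + profile G σ i
  ∎)
  where
  open ≤-Reasoning
  m = numEdges G
  i<n = <-trans (n<1+n i) si<n
  τ : Permutation′ n
  τ = transpose (fromℕ< i<n) (fromℕ< si<n) ∘ₚ σ
  first : Permutation′ n → Fin m → ℕ
  first π j = firstPosition π (edgeAt G j)
  total : Permutation′ n → ℕ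
  total π = sum (first π)
  SVC≡m+total : ∀ π → SVC G π ≡ m + total π
  SVC≡m+total π = trans (SVC≡∑suc-firstPosition G π)
    (trans (∑-distrib-+ (λ _ → 1) (first π)) (cong (_+ total π) (trans (∑-const m 1) (*-identityʳ m))))
  σ≤τ : m + total σ ≤ m + total τ
  σ≤τ = subst₂ _≤_ (SVC≡m+total σ) (SVC≡m+total τ) (optimal τ)
  edge-shift : ∀ e → firstPosition τ e + 𝟙 (firstPosition σ e ≟ suc i) ≤ firstPosition σ e + 𝟙 (firstPosition σ e ≟ i)
  edge-shift (u , v) = ⊓-shift {toℕ (σ ⟨$⟩ˡ u)} {toℕ (σ ⟨$⟩ˡ v)} i (suc i) (transpose-shift i<n si<n (σ ⟨$⟩ˡ u)) (transpose-shift i<n si<n (σ ⟨$⟩ˡ v))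

profile-antitone : ∀ {n} (G : Graph n) (σ : Permutation′ n) → Optimal G σ →
  ∀ {i j} → i ≤ j → j < n → profile G σ j ≤ profile G σ i
profile-antitone G σ optimal {j = zero} z≤n _ = ≤-refl
profile-antitone G σ optimal {i} {suc j} i≤sj sj<n with m≤n⇒m<n∨m≡n i≤sj
... | inj₂ refl = ≤-refl
... | inj₁ i<sj = ≤-trans (profile-step G σ optimal sj<n)
                          (profile-antitone G σ optimal (s≤s⁻¹ i<sj) (<-trans (n<1+n j) sj<n))

-- The last position covers no edge, so for odd n the profile lives on the first
-- 2⌊n/2⌋ positions.
module _ {n k} (G : Graph n) (σ : Permutation′ n) (halves : Halves n k) where

  private
    m = numEdges G
    N = k + k
    first : Fin m → ℕ
    first j = firstPosition σ (edgeAt G j)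

  firstPosition<2k : ∀ j → first j < N
  firstPosition<2k j = s≤s⁻¹ (<-≤-trans
    (suc-firstPosition<n σ (λ u≡v → <-irrefl (cong toℕ u≡v) (edgeAt-ordered G j))) (halves-≥ halves))

  numEdges≡∑profile : m ≡ ∑[ i < N ] profile G σ (toℕ i)
  numEdges≡∑profile = begin
      m
    ≡⟨ sym (trans (∑-const m 1) (*-identityʳ m)) ⟩
      ∑[ j < m ] 1
    ≡⟨ profile-formula G σ firstPosition<2k (λ _ → 1) ⟩
      ∑[ i < N ] (1 * profile G σ (toℕ i))
    ≡⟨ ∑-cong {N} (λ i → *-identityˡ _) ⟩
      ∑[ i < N ] profile G σ (toℕ i)
    ∎
    where open ≡-Reasoning

  SVC≡∑profile : SVC G σ ≡ ∑[ i < N ] (suc (toℕ i) * profile G σ (toℕ i))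
  SVC≡∑profile = trans (SVC≡∑suc-firstPosition G σ) (profile-formula G σ firstPosition<2k suc)

  coveredInHalf≡∑profile : coveredInHalf G σ ≡ ∑[ i < N ] (𝟙 (toℕ i <? k) * profile G σ (toℕ i))
  coveredInHalf≡∑profile = begin
      coveredInHalf G σ
    ≡⟨ length-filter≡∑𝟙 (λ e → 2 * coverTime σ e ≤? n) (edges G) ⟩
      ∑[ j < m ] 𝟙 (2 * coverTime σ (edgeAt G j) ≤? n)
    ≡⟨ ∑-cong {m} (λ j → cong (λ t → 𝟙 (2 * t ≤? n)) (coverTime≡suc-firstPosition σ (edgeAt G j))) ⟩
      ∑[ j < m ] 𝟙 (2 * suc (first j) ≤? n)
    ≡⟨ profile-formula G σ firstPosition<2k (λ t → 𝟙 (2 * suc t ≤? n)) ⟩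
      ∑[ i < N ] (𝟙 (2 * suc (toℕ i) ≤? n) * profile G σ (toℕ i))
    ≡⟨ ∑-cong {N} (λ i → cong (_* profile G σ (toℕ i)) (𝟙-cong (2 * suc (toℕ i) ≤? n) (toℕ i <? k)
                     (2*[1+i]≤n⇒i<k halves) (i<k⇒2*[1+i]≤n halves))) ⟩
      ∑[ i < N ] (𝟙 (toℕ i <? k) * profile G σ (toℕ i))
    ∎
    where open ≡-Reasoning

uncovered-bound : ∀ {n} (G : Graph n) {d} → (∀ v → degree G v ≡ d) →
  (σ : Permutation′ n) → Optimal G σ →
  let m = numEdges G; u = m ∸ coveredInHalf G σ in
  m * m + 4 * (u * u) ≤ d * (2 * SVC G σ)
uncovered-bound {n} G {d} regular σ optimal with D , m≡kd+D , 2D≤d ← half-product (halves n) (handshake G regular) =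
  subst₂ _≤_
    (cong₂ (λ m c → m * m + 4 * ((m ∸ c) * (m ∸ c)))
      (sym (numEdges≡∑profile G σ (halves n))) (sym (coveredInHalf≡∑profile G σ (halves n))))
    (cong (λ S → d * (2 * S)) (sym (SVC≡∑profile G σ (halves n))))
    (profile-bound k D f f≤d antitone (trans (sym (numEdges≡∑profile G σ (halves n))) m≡kd+D) 2D≤d)
  where
  k = ⌊ n /2⌋
  f : Fin (k + k) → ℕ
  f i = profile G σ (toℕ i)
  inside : (i : Fin (k + k)) → toℕ i < n
  inside i = <-≤-trans (toℕ<n i) (halves-≤ (halves n))
  f≤d : ∀ i → f i ≤ d
  f≤d i = ≤-trans (profile≤degree G σ (inside i)) (≤-reflexive (regular _))
  antitone : Antitone f
  antitone i≤j = profile-antitone G σ optimal i≤j (inside _)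

mainTheorem8 : ∀ {n} (G : Graph n) → Regular G →
    0 < numEdges G →
    (σ : Permutation′ n) → Optimal G σ →
    numEdges G * n ≤ 4 * SVC G σ →
    4 * n * ((numEdges G ∸ coveredInHalf G σ) * (numEdges G ∸ coveredInHalf G σ))
      ≤ (4 * SVC G σ ∸ numEdges G * n) * numEdges G
mainTheorem8 {n} G (d , regular) _ σ optimal _ =
  rescale-bound n d (numEdges G) (SVC G σ) (numEdges G ∸ coveredInHalf G σ) (handshake G regular) (uncovered-bound G regular σ optimal)
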